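{- Let $n\geq1$ and consider the normed BPA system $\Delta_0$ described in the context. Let $\alpha$ be a process with $\mathrm{Var}(\alpha)\subseteq\mathcal{B}$, $1\le i\le n$, $b\in\{0,1\}$. Then $Z_i^b\alpha\simeq\alpha$ if and only if $Z_i^b\alpha\approx\alpha$.
   Context: BPA systems: a BPA system $(\mathcal{V},\mathcal{A},\mathcal{R})$ has finite sets of variables, actions (containing the internal action $\tau$) and rules $X\xrightarrow{\lambda}\alpha$; processes are words over $\mathcal{V}$; if $X\xrightarrow{\lambda}\alpha$ is a rule then $X\beta\xrightarrow{\lambda}\alpha\beta$. Write $\to$ for $\xrightarrow{\tau}$, $\Rightarrow$ for its reflexive transitive closure, $\mathrm{Var}(\alpha)$ for the set of variables occurring in $\alpha$. A symmetric relation $R$ is a branching bisimulation if whenever $\alpha R\beta$ and $\alpha\xrightarrow{\lambda}\alpha'$, either ($\lambda=\tau$ and $\alpha'R\beta$) or $\beta\Rightarrow\beta''\xrightarrow{\lambda}\beta'$ with $\alpha R\beta''$ and $\alpha'R\beta'$; it is a weak bisimulation if whenever $\alpha R\beta$ and $\alpha\xrightarrow{\lambda}\alpha'$, either ($\lambda=\tau$ and $\alpha'R\beta$) or $\beta\Rightarrow\gamma_1\xrightarrow{\lambda}\gamma_2\Rightarrow\beta'$ with $\alpha'R\beta'$. $\simeq$ and $\approx$ are the largest branching and weak bisimulations. The system $\Delta_0$: variables $\mathcal{B}\uplus\mathcal{B}'$ with $\mathcal{B}=\{B_i^0,B_i^1\mid 1\le i\le n\}$ and $\mathcal{B}'=\{Z_i^0,Z_i^1\mid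 1\le i\le n\}\cup\{B_i^b(j,b')\mid 1\le i,j\le n,\ i\ne j,\ b,b'\in\{0,1\}\}$; actions $\{d,\tau\}\cup\{a_i^0,a_i^1\mid 1\le i\le n\}$; rules, for all $1\le i,j,j'\le n$ and $b,b',b''\in\{0,1\}$: $Z_i^b\xrightarrow{a_i^b}\epsilon$, $Z_i^b\xrightarrow{\tau}\epsilon$; $B_i^b\xrightarrow{a_i^b}B_i^b$, $B_i^b\xrightarrow{d}\epsilon$, $B_i^b\xrightarrow{a_j^{b'}}B_i^b(j,b')$ for $j\ne i$; $B_i^b(j,b')\xrightarrow{a_i^b}B_i^b(j,b')$, $B_i^b(j,b')\xrightarrow{d}Z_j^{b'}$, $B_i^b(j,b')\xrightarrow{a_{j'}^{b''}}B_i^b(j',b'')$ for $j\ne i$, $j'\ne i$. -}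

module Defs where

open import Data.Nat using (ℕ)
open import Data.Fin using (Fin)
open import Data.Bool using (Bool)
open import Data.List using (List; []; _∷_; [_]; _++_)
open import Data.Product using (Σ; ∃; ∃-syntax; _×_; _,_)
open import Data.Sum using (_⊎_)
open import Relation.Binary.PropositionalEquality using (_≡_; _≢_)
open import Relation.Binary.Construct.Closure.ReflexiveTransitive using (Star)

-- Variables of Δ₀ (for a fixed n).
--   B i b          = B_i^b        (the set 𝓑)
--   Z i b          = Z_i^b
--   Bc i b j b' _  = B_i^b(j,b')  (only for i ≠ j)
data Var (n : ℕ) : Set where
  B  : Fin n → Bool → Var n
  Z  : Fin n → Bool → Var n
  Bc : (i : Fin n) (b : Bool) (j : Fin n) (b' : Bool) → .(i ≢ j) → Var n

data Act (n : ℕ) : Set where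
  τ : Act n
  d : Act n
  a : Fin n → Bool → Act n

Proc : ℕ → Set
Proc n = List (Var n)

data Rule {n : ℕ} : Var n → Act n → Proc n → Set where
  Z-a   : ∀ {i b} → Rule (Z i b) (a i b) []
  Z-τ   : ∀ {i b} → Rule (Z i b) τ []
  B-a   : ∀ {i b} → Rule (B i b) (a i b) [ B i b ]
  B-d   : ∀ {i b} → Rule (B i b) d []
  B-aj  : ∀ {i b j b'} (p : i ≢ j) → Rule (B i b) (a j b') [ Bc i b j b' p ]
  Bc-a  : ∀ {i b j b'} .{p : i ≢ j} → Rule (Bc i b j b' p) (a i b) [ Bc i b j b' p ]
  Bc-d  : ∀ {i b j b'} .{p : i ≢ j} → Rule (Bc i b j b' p) d [ Z j b' ]
  Bc-aj : ∀ {i b j b' j' b''} .{p : i ≢ j} (q : i ≢ j') →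
          Rule (Bc i b j b' p) (a j' b'') [ Bc i b j' b'' q ]

data Step {n : ℕ} : Proc n → Act n → Proc n → Set where
  step : ∀ {X λ' α β} → Rule X λ' α → Step (X ∷ β) λ' (α ++ β)

_⟶τ_ : ∀ {n} → Proc n → Proc n → Set
α ⟶τ α' = Step α τ α'

_⇒_ : ∀ {n} → Proc n → Proc n → Set
_⇒_ = Star _⟶τ_

Rel : ℕ → Set₁
Rel n = Proc n → Proc n → Set

Symmetric : ∀ {n} → Rel n → Set
Symmetric R = ∀ {α β} → R α β → R β α

IsBranchingBisim : ∀ {n} → Rel n → Set
IsBranchingBisim {n} R =
  Symmetric R ×
  (∀ {α β α' : Proc n} {λ' : Act n} → R α β → Step α λ' α' →
     (λ' ≡ τ × R α' β) ⊎
     (∃[ β'' ] ∃[ β' ] (β ⇒ β'' × Step β'' λ' β' × R α β'' × R α' β')))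

IsWeakBisim : ∀ {n} → Rel n → Set
IsWeakBisim {n} R =
  Symmetric R ×
  (∀ {α β α' : Proc n} {λ' : Act n} → R α β → Step α λ' α' →
     (λ' ≡ τ × R α' β) ⊎
     (∃[ γ₁ ] ∃[ γ₂ ] ∃[ β' ] (β ⇒ γ₁ × Step γ₁ λ' γ₂ × γ₂ ⇒ β' × R α' β')))

-- Branching bisimilarity ≃ (largest branching bisimulation = union of all)
_≃_ : ∀ {n} → Proc n → Proc n → Set₁
_≃_ {n} α β = Σ (Rel n) λ R → IsBranchingBisim R × R α β

_≈_ : ∀ {n} → Proc n → Proc n → Set₁
_≈_ {n} α β = Σ (Rel n) λ R → IsWeakBisim R × R α β

data InB {n : ℕ} : Var n → Set where
  inB : ∀ {i b} → InB (B i b)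

module Submission where

-- Branching bisimilarity always implies weak bisimilarity, so
-- only the converse needs work.  Both directions pass through an explicit
-- description of when Z_i^b may be dropped in front of α ∈ 𝓑*:
--
--   α absorbs Z_i^b  ⇔  α = B_{j₁}^{c₁} ⋯ B_{jₖ}^{cₖ} B_i^b β  with every jₗ ≠ i.
--
-- Necessity (for weak bisimulations): processes headed by a variable of 𝓑 or
-- by some B_j^c(i,b) have no τ-moves, so α must answer the visible move
-- Z_i^b α ─a_i^b→ α directly.  Either α starts with B_i^b, or α = B_j^c β with
-- j ≠ i moves to B_j^c(i,b) β, whose d-move to Z_i^b β forces Z_i^b β to be
-- related to β again; recursion on β finishes the argument.
-- Sufficiency (for branching bisimulations): the relation pairing Z_i^b α with
-- α, and B_j^c(i,b) β with B_j^c β, whenever α, β absorb Z_i^b, is a branching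
-- bisimulation.

open import Defs
open import Data.Nat using (ℕ; _≤_)
open import Data.Fin using (Fin)
open import Data.Bool using (Bool)
open import Data.List using (_∷_)
open import Data.List.Relation.Unary.All using (All; []; _∷_)
open import Data.Product using (∃-syntax; _×_; _,_; proj₁)
open import Data.Sum using (_⊎_; inj₁; inj₂)
open import Function.Bundles using (_⇔_; mk⇔)
open import Relation.Nullary using (¬_; contradiction)
open import Relation.Binary.PropositionalEquality using (_≡_; _≢_; refl)
open import Relation.Binary.Construct.Closure.ReflexiveTransitive using (ε; _◅_)

-- Every branching bisimulation is a weak bisimulation: a branching answer
-- β ⇒ β'' ─λ→ β' is a weak answer with an empty trailing τ-sequence.
branching⇒weak : ∀ {n} {R : Rel n} → IsBranchingBisim R → IsWeakBisim R
branching⇒weak {n} {R} (sym , sim) =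
  sym , λ {α} {_} {α'} r s → weaken {α = α} {α' = α'} (sim r s)
  where
  weaken : ∀ {α β α' : Proc n} {λ' : Act n} →
    (λ' ≡ τ × R α' β) ⊎
      (∃[ β'' ] ∃[ β' ] (β ⇒ β'' × Step β'' λ' β' × R α β'' × R α' β')) →
    (λ' ≡ τ × R α' β) ⊎
      (∃[ γ₁ ] ∃[ γ₂ ] ∃[ β' ] (β ⇒ γ₁ × Step γ₁ λ' γ₂ × γ₂ ⇒ β' × R α' β'))
  weaken (inj₁ silent) = inj₁ silent
  weaken (inj₂ (β'' , β' , τs , s , _ , r')) = inj₂ (β'' , β' , β' , τs , s , ε , r')

Stable : ∀ {n} → Proc n → Set
Stable {n} α = ∀ {γ : Proc n} → α ⇒ γ → γ ≡ α

stable-head : ∀ {n} {X : Var n} {β : Proc n} →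
  (∀ {α} → ¬ Rule X τ α) → Stable (X ∷ β)
stable-head noτ ε = refl
stable-head noτ (step rule ◅ _) with noτ rule
... | ()

stable-𝓑 : ∀ {n} {α : Proc n} → All InB α → Stable α
stable-𝓑 [] ε = refl
stable-𝓑 [] (() ◅ _)
stable-𝓑 (inB ∷ _) = stable-head λ ()

stable-Bc : ∀ {n} {j i : Fin n} {c b} .{p : j ≢ i} {β : Proc n} →
  Stable (Bc j c i b p ∷ β)
stable-Bc = stable-head λ ()

visible-answer : ∀ {n} {R : Rel n} {α β α' : Proc n} {λ' : Act n} →
  IsWeakBisim R → R α β → Step α λ' α' → λ' ≢ τ → Stable β →
  ∃[ γ ] ∃[ β' ] (Step β λ' γ × γ ⇒ β' × R α' β')
visible-answer (_ , sim) r s visible stable with sim r s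
... | inj₁ (silent , _) = contradiction silent visible
... | inj₂ (_ , γ , β' , τs , s' , τs' , r') with stable τs
...   | refl = γ , β' , s' , τs' , r'

data Absorbs {n : ℕ} (i : Fin n) (b : Bool) : Proc n → Set where
  here  : ∀ {β} → Absorbs i b (B i b ∷ β)
  there : ∀ {j c β} (p : j ≢ i) → Absorbs i b β → Absorbs i b (B j c ∷ β)

-- The a_i^b-move of Z_i^b is answered either by B_i^b, or by B_j^c
-- (j ≠ i) moving to B_j^c(i,b) β; the latter's d-move to Z_i^b β can only be
-- answered by B_j^c β ─d→ β, which relates Z_i^b β to β.
absorbs-if-weak : ∀ {n} {R : Rel n} → IsWeakBisim R → (i : Fin n) (b : Bool) →
  ∀ {α} → All InB α → R (Z i b ∷ α) α → Absorbs i b α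
absorbs-if-weak W i b [] r
  with visible-answer W r (step Z-a) (λ ()) (stable-𝓑 [])
... | _ , _ , () , _
absorbs-if-weak W i b 𝓑α@(inB ∷ 𝓑β) r
  with visible-answer W r (step Z-a) (λ ()) (stable-𝓑 𝓑α)
... | _ , _ , step B-a , _ = here
... | _ , _ , step (B-aj p) , τs , r' with stable-Bc τs
...   | refl with visible-answer W (proj₁ W r') (step Bc-d) (λ ()) (stable-𝓑 𝓑α)
...     | _ , _ , step B-d , τs' , r'' with stable-𝓑 𝓑β τs'
...       | refl = there p (absorbs-if-weak W i b 𝓑β r'')

-- The candidate branching bisimulation for dropping Z_i^b: besides the
-- identity, it relates Z_i^b α with α, and B_j^c(i,b) β (which will expose
-- Z_i^b β after its d-move) with B_j^c β, whenever α, β absorb Z_i^b.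
data Drop-Z {n : ℕ} (i : Fin n) (b : Bool) : Rel n where
  same     : ∀ {α} → Drop-Z i b α α
  drop     : ∀ {α} → Absorbs i b α → Drop-Z i b (Z i b ∷ α) α
  add      : ∀ {α} → Absorbs i b α → Drop-Z i b α (Z i b ∷ α)
  forget   : ∀ {j c β} (p : j ≢ i) → Absorbs i b β →
             Drop-Z i b (Bc j c i b p ∷ β) (B j c ∷ β)
  remember : ∀ {j c β} (p : j ≢ i) → Absorbs i b β →
             Drop-Z i b (B j c ∷ β) (Bc j c i b p ∷ β)

Drop-Z-sym : ∀ {n} {i : Fin n} {b} → Symmetric (Drop-Z i b)
Drop-Z-sym same            = same
Drop-Z-sym (drop ab)       = add ab
Drop-Z-sym (add ab)        = drop ab
Drop-Z-sym (forget p ab)   = remember p ab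
Drop-Z-sym (remember p ab) = forget p ab

-- Every move is matched
-- by the corresponding move of the partner (after discarding Z_i^b by a τ-step
-- where needed); the a_i^b-move of Z_i^b is matched by the first B of α that
-- can read a_i^b, i.e. B_i^b itself or some B_j^c turning into B_j^c(i,b).
Drop-Z-branching : ∀ {n} (i : Fin n) (b : Bool) → IsBranchingBisim (Drop-Z i b)
Drop-Z-branching i b = Drop-Z-sym , match
  where
  answer : ∀ {α β α' β' λ'} →
    Step β λ' β' → Drop-Z i b α β → Drop-Z i b α' β' →
    (λ' ≡ τ × Drop-Z i b α' β) ⊎
    (∃[ β'' ] ∃[ β' ] (β ⇒ β'' × Step β'' λ' β' × Drop-Z i b α β'' × Drop-Z i b α' β'))
  answer s r r' = inj₂ (_ , _ , ε , s , r , r')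

  match : ∀ {α β α' λ'} → Drop-Z i b α β → Step α λ' α' →
    (λ' ≡ τ × Drop-Z i b α' β) ⊎
    (∃[ β'' ] ∃[ β' ] (β ⇒ β'' × Step β'' λ' β' × Drop-Z i b α β'' × Drop-Z i b α' β'))
  match same s                           = answer s same same
  match (drop ab) (step Z-τ)             = inj₁ (refl , same)
  match (drop here) (step Z-a)           = answer (step B-a) (drop here) same
  match (drop (there p ab)) (step Z-a)   =
    answer (step (B-aj p)) (drop (there p ab)) (remember p ab)
  match (add ab) s                       = inj₂ (_ , _ , step Z-τ ◅ ε , s , same , same)
  match (forget p ab) (step Bc-a)        = answer (step B-a) (forget p ab) (forget p ab)
  match (forget p ab) (step Bc-d)        = answer (step B-d) (forget p ab) (drop ab)
  match (forget p ab) (step (Bc-aj q))   = answer (step (B-aj q)) (forget p ab) same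
  match (remember p ab) (step B-a)       = answer (step Bc-a) (remember p ab) (remember p ab)
  match (remember p ab) (step B-d)       = answer (step Bc-d) (remember p ab) (add ab)
  match (remember p ab) (step (B-aj q))  = answer (step (Bc-aj q)) (remember p ab) same

lemma13 : (n : ℕ) → 1 ≤ n → (α : Proc n) → All InB α → (i : Fin n) (b : Bool) →
    ((Z i b ∷ α) ≃ α) ⇔ ((Z i b ∷ α) ≈ α)
lemma13 n _ α 𝓑α i b = mk⇔ branching→weak weak→branching
  where
  branching→weak : (Z i b ∷ α) ≃ α → (Z i b ∷ α) ≈ α
  branching→weak (R , isBranching , r) = R , branching⇒weak isBranching , r

  weak→branching : (Z i b ∷ α) ≈ α → (Z i b ∷ α) ≃ α
  weak→branching (R , isWeak , r) =
    Drop-Z i b , Drop-Z-branching i b , drop (absorbs-if-weak isWeak i b 𝓑α r)
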